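{- For every positive integer $n\notin\{2,3,5\}$, the complete graph $K_n$ admits a $\mu$-simultaneous edge coloring for $\mu=2$ and for $\mu=3$.
   Context: $[l]=\{1,\ldots,l\}$. A $\mu$-simultaneous edge coloring of a graph $G$ is a $\mu$-tuple $(c_1,\ldots,c_\mu)$ of proper edge colorings $c_i:E(G)\to[l]$ (with a common color set $[l]$) such that (1) for every vertex $v$, the set $\{c_i(e): e \text{ incident to } v\}$ is the same for all $i$, and (2) $c_i(e)\neq c_j(e)$ for every edge $e$ and all $i\neq j$. -}

module Defs where

open import Data.Nat using (ℕ; suc)
open import Data.Fin using (Fin; _<_)
open import Data.Product using (Σ; ∃; ∃-syntax; _×_; _,_; proj₁; proj₂)
open import Data.Sum using (_⊎_)
open import Relation.Binary.PropositionalEquality using (_≡_)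
open import Relation.Nullary using (¬_)

-- The complete graph K_n: vertex set Fin n, edges are the pairs {u,v}
-- represented uniquely as (u , v) with u < v.
Edge : ℕ → Set
Edge n = Σ (Fin n) λ u → Σ (Fin n) λ v → u < v

endpoint₁ : ∀ {n} → Edge n → Fin n
endpoint₁ (u , _ , _) = u

endpoint₂ : ∀ {n} → Edge n → Fin n
endpoint₂ (_ , v , _) = v

Incident : ∀ {n} → Edge n → Fin n → Set
Incident e x = endpoint₁ e ≡ x ⊎ endpoint₂ e ≡ x

Adjacent : ∀ {n} → Edge n → Edge n → Set
Adjacent e f = ¬ (e ≡ f) × ∃[ x ] (Incident e x × Incident f x)

Colouring : ℕ → ℕ → Set
Colouring n l = Edge n → Fin l

Proper : ∀ {n l} → Colouring n l → Set
Proper c = ∀ e f → Adjacent e f → ¬ (c e ≡ c f)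

ColourAt : ∀ {n l} → Colouring n l → Fin _ → Fin l → Set
ColourAt {n} c x k = ∃[ e ] (Incident {n} e x × c e ≡ k)

record SimultaneousColouring (μ n l : ℕ) : Set where
  field
    col       : Fin μ → Colouring n l
    proper    : ∀ i → Proper (col i)
    sameSets  : ∀ i j (x : Fin n) (k : Fin l) →
                (ColourAt (col i) x k → ColourAt (col j) x k)
    distinct  : ∀ i j (e : Edge n) → ¬ (i ≡ j) → ¬ (col i e ≡ col j e)

AdmitsSimultaneous : ℕ → ℕ → Set
AdmitsSimultaneous μ n = ∃[ l ] SimultaneousColouring μ n l

module Submission where

-- Small cases (n = 1, 4, 6, 7, 9) are given by explicit tables checked by evaluation. Every
-- other n ∉ {0, 2, 3, 5} is 4 + m with m ≥ 4 and m ≠ 5, and K_{4+m} is obtained by joining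
-- K_4 and K_m: each clique keeps its own colours, and in the i-th colouring the cross edge
-- {u, v} gets the fresh colour ρ_i(u) + v mod m, where ρ_0, ρ_1, ρ_2 are distinct cyclic
-- shifts of Z_4. Then a vertex v of K_m sees the cross colours v + {0, 1, 2, 3} and a vertex
-- of K_4 sees all of Z_m, independently of i, while ρ_i(u) ≠ ρ_j(u) keeps the colourings
-- disjoint on every edge. Dropping one of the three colourings gives the case μ = 2.

open import Defs

open import Data.Empty using (⊥-elim)
open import Data.Fin using (Fin; toℕ; _≟_; #_)
open import Data.Fin.Properties using (all?; any?; +↔⊎; inject₁-injective; <⇒≢; <-irrelevant; <-asym; <-cmp; toℕ<n; toℕ-injective; toℕ-fromℕ<)
open import Data.Nat using (ℕ; suc; _+_; _∸_; _≤_; _<_; _%_; NonZero; z≤n; s≤s)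
open import Data.Nat.DivMod using (_mod_; %-distribˡ-+; m%n%n≡m%n; [m+n]%n≡m%n; m<n⇒m%n≡m)
open import Data.Nat.Properties using (+-comm; +-assoc; m+[n∸m]≡n; ≤-trans; ≤-refl; <⇒≤; n≤1+n)
open import Data.Product using (Σ; ∃-syntax; _×_; _,_; map₂)
open import Data.Sum using (_⊎_; inj₁; inj₂)
open import Data.Sum.Function.Propositional using (_⊎-↔_)
open import Data.Sum.Properties using (inj₁-injective; inj₂-injective)
open import Data.Vec using (Vec; _∷_; []; lookup)
open import Function using (_∘_)
open import Function.Bundles using (_↣_; _↔_; Injection; Inverse; mk↣)
open import Function.Properties.Inverse using (↔⇒↣; ↔-refl; ↔-sym; ↔-trans)
open import Relation.Binary.Definitions using (tri<; tri≈; tri>)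
open import Relation.Binary.PropositionalEquality
  using (_≡_; _≢_; refl; sym; trans; cong; module ≡-Reasoning)
open import Relation.Nullary using (¬_; Dec; ¬?)
open import Relation.Nullary.Decidable using (True; toWitness; _×-dec_; _→-dec_)

module _ (d : ℕ) .{{_ : NonZero d}} where
  open ≡-Reasoning

  [m%d+n]%d≡[m+n]%d : ∀ m n → (m % d + n) % d ≡ (m + n) % d
  [m%d+n]%d≡[m+n]%d m n = begin
    (m % d + n) % d          ≡⟨ %-distribˡ-+ (m % d) n d ⟩
    (m % d % d + n % d) % d  ≡⟨ cong (λ k → (k + n % d) % d) (m%n%n≡m%n m d) ⟩
    (m % d + n % d) % d      ≡⟨ %-distribˡ-+ m n d ⟨
    (m + n) % d              ∎

  [m+n%d]%d≡[m+n]%d : ∀ m n → (m + n % d) % d ≡ (m + n) % d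
  [m+n%d]%d≡[m+n]%d m n = begin
    (m + n % d) % d  ≡⟨ cong (_% d) (+-comm m (n % d)) ⟩
    (n % d + m) % d  ≡⟨ [m%d+n]%d≡[m+n]%d n m ⟩
    (n + m) % d      ≡⟨ cong (_% d) (+-comm n m) ⟩
    (m + n) % d      ∎

  r+[x+[d∸r]]≡x+d : ∀ {r} x → r ≤ d → r + (x + (d ∸ r)) ≡ x + d
  r+[x+[d∸r]]≡x+d {r} x r≤d = begin
    r + (x + (d ∸ r))  ≡⟨ cong (r +_) (+-comm x (d ∸ r)) ⟩
    r + ((d ∸ r) + x)  ≡⟨ +-assoc r (d ∸ r) x ⟨
    r + (d ∸ r) + x    ≡⟨ cong (_+ x) (m+[n∸m]≡n r≤d) ⟩
    d + x              ≡⟨ +-comm d x ⟩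
    x + d              ∎

  unshift-shift : ∀ {r x} → r ≤ d → x < d → ((r + x) % d + (d ∸ r)) % d ≡ x
  unshift-shift {r} {x} r≤d x<d = begin
    ((r + x) % d + (d ∸ r)) % d  ≡⟨ [m%d+n]%d≡[m+n]%d (r + x) (d ∸ r) ⟩
    (r + x + (d ∸ r)) % d        ≡⟨ cong (_% d) (+-assoc r x (d ∸ r)) ⟩
    (r + (x + (d ∸ r))) % d      ≡⟨ cong (_% d) (r+[x+[d∸r]]≡x+d x r≤d) ⟩
    (x + d) % d                  ≡⟨ [m+n]%n≡m%n x d ⟩
    x % d                        ≡⟨ m<n⇒m%n≡m x<d ⟩
    x                            ∎

  shift-unshift : ∀ {r x} → r ≤ d → x < d → (r + (x + (d ∸ r)) % d) % d ≡ x
  shift-unshift {r} {x} r≤d x<d = begin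
    (r + (x + (d ∸ r)) % d) % d  ≡⟨ [m+n%d]%d≡[m+n]%d r (x + (d ∸ r)) ⟩
    (r + (x + (d ∸ r))) % d      ≡⟨ cong (_% d) (r+[x+[d∸r]]≡x+d x r≤d) ⟩
    (x + d) % d                  ≡⟨ [m+n]%n≡m%n x d ⟩
    x % d                        ≡⟨ m<n⇒m%n≡m x<d ⟩
    x                            ∎

  +-%-cancelˡ : ∀ {r x y} → r ≤ d → x < d → y < d → (r + x) % d ≡ (r + y) % d → x ≡ y
  +-%-cancelˡ {r} {x} {y} r≤d x<d y<d eq = begin
    x                            ≡⟨ unshift-shift r≤d x<d ⟨
    ((r + x) % d + (d ∸ r)) % d  ≡⟨ cong (λ k → (k + (d ∸ r)) % d) eq ⟩
    ((r + y) % d + (d ∸ r)) % d  ≡⟨ unshift-shift r≤d y<d ⟩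
    y                            ∎

record LatinRectangle (m n : ℕ) : Set where
  field
    entry            : Fin m → Fin n → Fin n
    row-injective    : ∀ k {v w} → entry k v ≡ entry k w → v ≡ w
    row-surjective   : ∀ k w → ∃[ v ] entry k v ≡ w
    column-injective : ∀ v {k k′} → entry k v ≡ entry k′ v → k ≡ k′

cyclicLatinRectangle : ∀ {m n} .{{_ : NonZero n}} → m ≤ n → LatinRectangle m n
cyclicLatinRectangle {m} {n} m≤n = record
  { entry            = entry
  ; row-injective    = row-injective
  ; row-surjective   = row-surjective
  ; column-injective = column-injective
  }
  where
  open ≡-Reasoning

  entry : Fin m → Fin n → Fin n
  entry k v = (toℕ k + toℕ v) mod n

  toℕ-entry : ∀ k v → toℕ (entry k v) ≡ (toℕ k + toℕ v) % n
  toℕ-entry k v = toℕ-fromℕ< _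

  toℕ-entry-cong : ∀ k v k′ w → entry k v ≡ entry k′ w → (toℕ k + toℕ v) % n ≡ (toℕ k′ + toℕ w) % n
  toℕ-entry-cong k v k′ w eq = trans (sym (toℕ-entry k v)) (trans (cong toℕ eq) (toℕ-entry k′ w))

  toℕ<n′ : (k : Fin m) → toℕ k < n
  toℕ<n′ k = ≤-trans (toℕ<n k) m≤n

  toℕ≤n : (k : Fin m) → toℕ k ≤ n
  toℕ≤n k = <⇒≤ (toℕ<n′ k)

  row-injective : ∀ k {v w} → entry k v ≡ entry k w → v ≡ w
  row-injective k {v} {w} eq =
    toℕ-injective (+-%-cancelˡ n (toℕ≤n k) (toℕ<n v) (toℕ<n w) (toℕ-entry-cong k v k w eq))

  row-surjective : ∀ k w → ∃[ v ] entry k v ≡ w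
  row-surjective k w = v , toℕ-injective (begin
    toℕ (entry k v)                          ≡⟨ toℕ-entry k v ⟩
    (toℕ k + toℕ v) % n                      ≡⟨ cong (λ x → (toℕ k + x) % n) (toℕ-fromℕ< _) ⟩
    (toℕ k + (toℕ w + (n ∸ toℕ k)) % n) % n  ≡⟨ shift-unshift n (toℕ≤n k) (toℕ<n w) ⟩
    toℕ w                                    ∎)
    where
    v : Fin n
    v = (toℕ w + (n ∸ toℕ k)) mod n

  column-injective : ∀ v {k k′} → entry k v ≡ entry k′ v → k ≡ k′
  column-injective v {k} {k′} eq =
    toℕ-injective (+-%-cancelˡ n (<⇒≤ (toℕ<n v)) (toℕ<n′ k) (toℕ<n′ k′) (begin
      (toℕ v + toℕ k) % n   ≡⟨ cong (_% n) (+-comm (toℕ v) (toℕ k)) ⟩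
      (toℕ k + toℕ v) % n   ≡⟨ toℕ-entry-cong k v k′ v eq ⟩
      (toℕ k′ + toℕ v) % n  ≡⟨ cong (_% n) (+-comm (toℕ k′) (toℕ v)) ⟩
      (toℕ v + toℕ k′) % n  ∎))

-- A μ-tuple of colourings of the complete graph on V, each given as a function on ordered
-- pairs of vertices; only its values on pairs of distinct vertices matter.
record PairColouring (μ : ℕ) (V C : Set) : Set where
  field
    colour      : Fin μ → V → V → C
    symmetric   : ∀ i x y → colour i x y ≡ colour i y x
    proper      : ∀ i x y z → x ≢ y → x ≢ z → colour i x y ≡ colour i x z → y ≡ z
    sameColours : ∀ i j x y → x ≢ y → ∃[ z ] (x ≢ z × colour j x z ≡ colour i x y)
    distinct    : ∀ i j x y → i ≢ j → x ≢ y → colour i x y ≢ colour j x y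

recolour : ∀ {μ V C D} → C ↣ D → PairColouring μ V C → PairColouring μ V D
recolour g P = record
  { colour      = λ i x y → to (colour i x y)
  ; symmetric   = λ i x y → cong to (symmetric i x y)
  ; proper      = λ i x y z x≢y x≢z eq → proper i x y z x≢y x≢z (injective eq)
  ; sameColours = λ i j x y x≢y → map₂ (map₂ (cong to)) (sameColours i j x y x≢y)
  ; distinct    = λ i j x y i≢j x≢y eq → distinct i j x y i≢j x≢y (injective eq)
  }
  where
  open Injection g using (to; injective)
  open PairColouring P

relabel : ∀ {μ V W C} → W ↔ V → PairColouring μ V C → PairColouring μ W C
relabel {W = W} f P = record
  { colour      = λ i x y → colour i (to x) (to y)
  ; symmetric   = λ i x y → symmetric i (to x) (to y)
  ; proper      = λ i x y z x≢y x≢z eq →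
      to-injective (proper i (to x) (to y) (to z) (≢-to x≢y) (≢-to x≢z) eq)
  ; sameColours = sameColours′
  ; distinct    = λ i j x y i≢j x≢y → distinct i j (to x) (to y) i≢j (≢-to x≢y)
  }
  where
  open Inverse f using (to; from; strictlyInverseˡ)
  open PairColouring P

  to-injective : ∀ {x y} → to x ≡ to y → x ≡ y
  to-injective = Injection.injective (↔⇒↣ f)

  ≢-to : {x y : W} → x ≢ y → to x ≢ to y
  ≢-to x≢y = x≢y ∘ to-injective

  sameColours′ : ∀ i j x y → x ≢ y →
                 ∃[ z ] (x ≢ z × colour j (to x) (to z) ≡ colour i (to x) (to y))
  sameColours′ i j x y x≢y with sameColours i j (to x) (to y) (≢-to x≢y)
  ... | z , tox≢z , eq =
    from z , (λ x≡ → tox≢z (trans (cong to x≡) (strictlyInverseˡ z))) ,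
    trans (cong (colour j (to x)) (strictlyInverseˡ z)) eq

module _ {μ a b : ℕ} {C D : Set} (ρ : LatinRectangle μ a) (σ : LatinRectangle a b)
         (A : PairColouring μ (Fin a) C) (B : PairColouring μ (Fin b) D) where
  private
    module ρ = LatinRectangle ρ
    module σ = LatinRectangle σ
    module A = PairColouring A
    module B = PairColouring B

    cross : Fin μ → Fin a → Fin b → Fin b
    cross i u v = σ.entry (ρ.entry i u) v

    colour : Fin μ → Fin a ⊎ Fin b → Fin a ⊎ Fin b → C ⊎ D ⊎ Fin b
    colour i (inj₁ x) (inj₁ y) = inj₁ (A.colour i x y)
    colour i (inj₂ x) (inj₂ y) = inj₂ (inj₁ (B.colour i x y))
    colour i (inj₁ u) (inj₂ v) = inj₂ (inj₂ (cross i u v))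
    colour i (inj₂ v) (inj₁ u) = inj₂ (inj₂ (cross i u v))

    ≢-inj₁ : ∀ {x y : Fin a} → inj₁ {B = Fin b} x ≢ inj₁ y → x ≢ y
    ≢-inj₁ x≢y = x≢y ∘ cong inj₁

    ≢-inj₂ : ∀ {x y : Fin b} → inj₂ {A = Fin a} x ≢ inj₂ y → x ≢ y
    ≢-inj₂ x≢y = x≢y ∘ cong inj₂

    cross-column-injective : ∀ {i j u v} → cross i u v ≡ cross j u v → i ≡ j
    cross-column-injective {u = u} {v} = ρ.column-injective u ∘ σ.column-injective v

    symmetric : ∀ i x y → colour i x y ≡ colour i y x
    symmetric i (inj₁ x) (inj₁ y) = cong inj₁ (A.symmetric i x y)
    symmetric i (inj₂ x) (inj₂ y) = cong (inj₂ ∘ inj₁) (B.symmetric i x y)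
    symmetric i (inj₁ u) (inj₂ v) = refl
    symmetric i (inj₂ v) (inj₁ u) = refl

    proper : ∀ i x y z → x ≢ y → x ≢ z → colour i x y ≡ colour i x z → y ≡ z
    proper i (inj₁ x) (inj₁ y) (inj₁ z) x≢y x≢z eq =
      cong inj₁ (A.proper i x y z (≢-inj₁ x≢y) (≢-inj₁ x≢z) (inj₁-injective eq))
    proper i (inj₂ x) (inj₂ y) (inj₂ z) x≢y x≢z eq =
      cong inj₂ (B.proper i x y z (≢-inj₂ x≢y) (≢-inj₂ x≢z) (inj₁-injective (inj₂-injective eq)))
    proper i (inj₁ u) (inj₂ v) (inj₂ w) _ _ eq =
      cong inj₂ (σ.row-injective (ρ.entry i u) (inj₂-injective (inj₂-injective eq)))
    proper i (inj₂ v) (inj₁ u) (inj₁ w) _ _ eq =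
      cong inj₁ (ρ.row-injective i (σ.column-injective v (inj₂-injective (inj₂-injective eq))))
    proper i (inj₁ _) (inj₁ _) (inj₂ _) _ _ ()
    proper i (inj₁ _) (inj₂ _) (inj₁ _) _ _ ()
    proper i (inj₂ _) (inj₁ _) (inj₂ _) _ _ ()
    proper i (inj₂ _) (inj₂ _) (inj₁ _) _ _ ()

    sameColours : ∀ i j x y → x ≢ y → ∃[ z ] (x ≢ z × colour j x z ≡ colour i x y)
    sameColours i j (inj₁ x) (inj₁ y) x≢y with A.sameColours i j x y (≢-inj₁ x≢y)
    ... | z , x≢z , eq = inj₁ z , x≢z ∘ inj₁-injective , cong inj₁ eq
    sameColours i j (inj₂ x) (inj₂ y) x≢y with B.sameColours i j x y (≢-inj₂ x≢y)
    ... | z , x≢z , eq = inj₂ z , x≢z ∘ inj₂-injective , cong (inj₂ ∘ inj₁) eq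
    sameColours i j (inj₁ u) (inj₂ v) _ with σ.row-surjective (ρ.entry j u) (cross i u v)
    ... | w , eq = inj₂ w , (λ ()) , cong (inj₂ ∘ inj₂) eq
    sameColours i j (inj₂ v) (inj₁ u) _ with ρ.row-surjective j (ρ.entry i u)
    ... | u′ , eq = inj₁ u′ , (λ ()) , cong (λ k → inj₂ (inj₂ (σ.entry k v))) eq

    distinct : ∀ i j x y → i ≢ j → x ≢ y → colour i x y ≢ colour j x y
    distinct i j (inj₁ x) (inj₁ y) i≢j x≢y = A.distinct i j x y i≢j (≢-inj₁ x≢y) ∘ inj₁-injective
    distinct i j (inj₂ x) (inj₂ y) i≢j x≢y =
      B.distinct i j x y i≢j (≢-inj₂ x≢y) ∘ inj₁-injective ∘ inj₂-injective
    distinct i j (inj₁ u) (inj₂ v) i≢j _ = i≢j ∘ cross-column-injective ∘ inj₂-injective ∘ inj₂-injective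
    distinct i j (inj₂ v) (inj₁ u) i≢j _ = i≢j ∘ cross-column-injective ∘ inj₂-injective ∘ inj₂-injective

  joinCliques : PairColouring μ (Fin a ⊎ Fin b) (C ⊎ D ⊎ Fin b)
  joinCliques = record
    { colour = colour ; symmetric = symmetric ; proper = proper
    ; sameColours = sameColours ; distinct = distinct }

otherEnd : ∀ {n x} (e : Edge n) → Incident e x → Fin n
otherEnd (_ , v , _) (inj₁ _) = v
otherEnd (u , _ , _) (inj₂ _) = u

otherEnd-≢ : ∀ {n x} (e : Edge n) (ex : Incident e x) → x ≢ otherEnd e ex
otherEnd-≢ (_ , _ , u<v) (inj₁ refl) = <⇒≢ u<v
otherEnd-≢ (_ , _ , u<v) (inj₂ refl) = <⇒≢ u<v ∘ sym

otherEnd-injective : ∀ {n x} (e f : Edge n) (ex : Incident e x) (fx : Incident f x) →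
                  otherEnd e ex ≡ otherEnd f fx → e ≡ f
otherEnd-injective (u , v , u<v) (_ , _ , u<v′) (inj₁ refl) (inj₁ refl) refl =
  cong (λ p → u , v , p) (<-irrelevant u<v u<v′)
otherEnd-injective (u , v , u<v) (_ , _ , v<u) (inj₁ refl) (inj₂ refl) refl = ⊥-elim (<-asym u<v v<u)
otherEnd-injective (u , v , u<v) (_ , _ , v<u) (inj₂ refl) (inj₁ refl) refl = ⊥-elim (<-asym u<v v<u)
otherEnd-injective (u , v , u<v) (_ , _ , u<v′) (inj₂ refl) (inj₂ refl) refl =
  cong (λ p → u , v , p) (<-irrelevant u<v u<v′)

edgeBetween : ∀ {n} {x y : Fin n} → x ≢ y → ∃[ e ] Σ (Incident e x) λ ex → otherEnd e ex ≡ y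
edgeBetween {x = x} {y} x≢y with <-cmp x y
... | tri< x<y _ _ = (x , y , x<y) , inj₁ refl , refl
... | tri≈ _ x≡y _ = ⊥-elim (x≢y x≡y)
... | tri> _ _ y<x = (y , x , y<x) , inj₂ refl , refl

module _ {μ n l} (P : PairColouring μ (Fin n) (Fin l)) where
  open PairColouring P

  edgeColouring : Fin μ → Colouring n l
  edgeColouring i (u , v , _) = colour i u v

  edgeColouring-otherEnd : ∀ i {x} (e : Edge n) (ex : Incident e x) →
                        edgeColouring i e ≡ colour i x (otherEnd e ex)
  edgeColouring-otherEnd i _ (inj₁ refl) = refl
  edgeColouring-otherEnd i (u , v , _) (inj₂ refl) = symmetric i u v

  toSimultaneous : SimultaneousColouring μ n l
  toSimultaneous = record
    { col      = edgeColouring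
    ; proper   = proper′
    ; sameSets = sameSets′
    ; distinct = λ { i j (u , v , u<v) i≢j → distinct i j u v i≢j (<⇒≢ u<v) }
    }
    where
    proper′ : ∀ i → Proper (edgeColouring i)
    proper′ i e f (e≢f , x , ex , fx) eq = e≢f (otherEnd-injective e f ex fx
      (proper i x _ _ (otherEnd-≢ e ex) (otherEnd-≢ f fx) (begin
        colour i x (otherEnd e ex)  ≡⟨ edgeColouring-otherEnd i e ex ⟨
        edgeColouring i e        ≡⟨ eq ⟩
        edgeColouring i f        ≡⟨ edgeColouring-otherEnd i f fx ⟩
        colour i x (otherEnd f fx)  ∎)))
      where open ≡-Reasoning

    sameSets′ : ∀ i j x k → ColourAt (edgeColouring i) x k → ColourAt (edgeColouring j) x k
    sameSets′ i j x k (e , ex , refl) with sameColours i j x (otherEnd e ex) (otherEnd-≢ e ex)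
    ... | z , x≢z , eq with edgeBetween x≢z
    ... | f , fx , refl = f , fx , (begin
      edgeColouring j f        ≡⟨ edgeColouring-otherEnd j f fx ⟩
      colour j x (otherEnd f fx)  ≡⟨ eq ⟩
      colour i x (otherEnd e ex)  ≡⟨ edgeColouring-otherEnd i e ex ⟨
      edgeColouring i e        ∎)
      where open ≡-Reasoning

restrict : ∀ {μ ν n l} → Fin ν ↣ Fin μ → SimultaneousColouring μ n l → SimultaneousColouring ν n l
restrict f S = record
  { col      = col ∘ to
  ; proper   = proper ∘ to
  ; sameSets = λ i j → sameSets (to i) (to j)
  ; distinct = λ i j e i≢j → distinct (to i) (to j) e (i≢j ∘ injective)
  }
  where
  open Injection f using (to; injective)
  open SimultaneousColouring S

module Decide {μ n l : ℕ} (c : Fin μ → Fin n → Fin n → Fin l) where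
  symmetric? : Dec (∀ i x y → c i x y ≡ c i y x)
  symmetric? = all? λ i → all? λ x → all? λ y → c i x y ≟ c i y x

  proper? : Dec (∀ i x y z → x ≢ y → x ≢ z → c i x y ≡ c i x z → y ≡ z)
  proper? = all? λ i → all? λ x → all? λ y → all? λ z →
    ¬? (x ≟ y) →-dec ¬? (x ≟ z) →-dec (c i x y ≟ c i x z) →-dec (y ≟ z)

  sameColours? : Dec (∀ i j x y → x ≢ y → ∃[ z ] (x ≢ z × c j x z ≡ c i x y))
  sameColours? = all? λ i → all? λ j → all? λ x → all? λ y →
    ¬? (x ≟ y) →-dec any? λ z → ¬? (x ≟ z) ×-dec (c j x z ≟ c i x y)

  distinct? : Dec (∀ i j x y → i ≢ j → x ≢ y → c i x y ≢ c j x y)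
  distinct? = all? λ i → all? λ j → all? λ x → all? λ y →
    ¬? (i ≟ j) →-dec ¬? (x ≟ y) →-dec ¬? (c i x y ≟ c j x y)

  fromDecisions : True symmetric? → True proper? → True sameColours? → True distinct? →
                  PairColouring μ (Fin n) (Fin l)
  fromDecisions s p c′ d = record
    { colour = c ; symmetric = toWitness s ; proper = toWitness p
    ; sameColours = toWitness c′ ; distinct = toWitness d }

fromTable : ∀ {μ n l} → Vec (Vec (Vec (Fin l) n) n) μ → Fin μ → Fin n → Fin n → Fin l
fromTable T i x y = lookup (lookup (lookup T i) x) y

table₁ : Vec (Vec (Vec (Fin 1) 1) 1) 3
table₁ =
    ( (# 0 ∷ [])
    ∷ [])
  ∷ ( (# 0 ∷ [])
    ∷ [])
  ∷ ( (# 0 ∷ [])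
    ∷ [])
  ∷ []

table₄ : Vec (Vec (Vec (Fin 3) 4) 4) 3
table₄ =
    ( (# 0 ∷ # 2 ∷ # 1 ∷ # 0 ∷ [])
    ∷ (# 2 ∷ # 0 ∷ # 0 ∷ # 1 ∷ [])
    ∷ (# 1 ∷ # 0 ∷ # 0 ∷ # 2 ∷ [])
    ∷ (# 0 ∷ # 1 ∷ # 2 ∷ # 0 ∷ [])
    ∷ [])
  ∷ ( (# 0 ∷ # 0 ∷ # 2 ∷ # 1 ∷ [])
    ∷ (# 0 ∷ # 0 ∷ # 1 ∷ # 2 ∷ [])
    ∷ (# 2 ∷ # 1 ∷ # 0 ∷ # 0 ∷ [])
    ∷ (# 1 ∷ # 2 ∷ # 0 ∷ # 0 ∷ [])
    ∷ [])
  ∷ ( (# 0 ∷ # 1 ∷ # 0 ∷ # 2 ∷ [])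
    ∷ (# 1 ∷ # 0 ∷ # 2 ∷ # 0 ∷ [])
    ∷ (# 0 ∷ # 2 ∷ # 0 ∷ # 1 ∷ [])
    ∷ (# 2 ∷ # 0 ∷ # 1 ∷ # 0 ∷ [])
    ∷ [])
  ∷ []

table₆ : Vec (Vec (Vec (Fin 5) 6) 6) 3
table₆ =
    ( (# 0 ∷ # 3 ∷ # 1 ∷ # 4 ∷ # 2 ∷ # 0 ∷ [])
    ∷ (# 3 ∷ # 0 ∷ # 4 ∷ # 2 ∷ # 0 ∷ # 1 ∷ [])
    ∷ (# 1 ∷ # 4 ∷ # 0 ∷ # 0 ∷ # 3 ∷ # 2 ∷ [])
    ∷ (# 4 ∷ # 2 ∷ # 0 ∷ # 0 ∷ # 1 ∷ # 3 ∷ [])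
    ∷ (# 2 ∷ # 0 ∷ # 3 ∷ # 1 ∷ # 0 ∷ # 4 ∷ [])
    ∷ (# 0 ∷ # 1 ∷ # 2 ∷ # 3 ∷ # 4 ∷ # 0 ∷ [])
    ∷ [])
  ∷ ( (# 0 ∷ # 4 ∷ # 2 ∷ # 0 ∷ # 3 ∷ # 1 ∷ [])
    ∷ (# 4 ∷ # 0 ∷ # 0 ∷ # 3 ∷ # 1 ∷ # 2 ∷ [])
    ∷ (# 2 ∷ # 0 ∷ # 0 ∷ # 1 ∷ # 4 ∷ # 3 ∷ [])
    ∷ (# 0 ∷ # 3 ∷ # 1 ∷ # 0 ∷ # 2 ∷ # 4 ∷ [])
    ∷ (# 3 ∷ # 1 ∷ # 4 ∷ # 2 ∷ # 0 ∷ # 0 ∷ [])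
    ∷ (# 1 ∷ # 2 ∷ # 3 ∷ # 4 ∷ # 0 ∷ # 0 ∷ [])
    ∷ [])
  ∷ ( (# 0 ∷ # 0 ∷ # 3 ∷ # 1 ∷ # 4 ∷ # 2 ∷ [])
    ∷ (# 0 ∷ # 0 ∷ # 1 ∷ # 4 ∷ # 2 ∷ # 3 ∷ [])
    ∷ (# 3 ∷ # 1 ∷ # 0 ∷ # 2 ∷ # 0 ∷ # 4 ∷ [])
    ∷ (# 1 ∷ # 4 ∷ # 2 ∷ # 0 ∷ # 3 ∷ # 0 ∷ [])
    ∷ (# 4 ∷ # 2 ∷ # 0 ∷ # 3 ∷ # 0 ∷ # 1 ∷ [])
    ∷ (# 2 ∷ # 3 ∷ # 4 ∷ # 0 ∷ # 1 ∷ # 0 ∷ [])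
    ∷ [])
  ∷ []

table₇ : Vec (Vec (Vec (Fin 7) 7) 7) 3
table₇ =
    ( (# 0 ∷ # 3 ∷ # 6 ∷ # 1 ∷ # 5 ∷ # 4 ∷ # 2 ∷ [])
    ∷ (# 3 ∷ # 0 ∷ # 4 ∷ # 0 ∷ # 2 ∷ # 6 ∷ # 5 ∷ [])
    ∷ (# 6 ∷ # 4 ∷ # 0 ∷ # 5 ∷ # 1 ∷ # 3 ∷ # 0 ∷ [])
    ∷ (# 1 ∷ # 0 ∷ # 5 ∷ # 0 ∷ # 6 ∷ # 2 ∷ # 4 ∷ [])
    ∷ (# 5 ∷ # 2 ∷ # 1 ∷ # 6 ∷ # 0 ∷ # 0 ∷ # 3 ∷ [])
    ∷ (# 4 ∷ # 6 ∷ # 3 ∷ # 2 ∷ # 0 ∷ # 0 ∷ # 1 ∷ [])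
    ∷ (# 2 ∷ # 5 ∷ # 0 ∷ # 4 ∷ # 3 ∷ # 1 ∷ # 0 ∷ [])
    ∷ [])
  ∷ ( (# 0 ∷ # 5 ∷ # 3 ∷ # 2 ∷ # 6 ∷ # 1 ∷ # 4 ∷ [])
    ∷ (# 5 ∷ # 0 ∷ # 6 ∷ # 4 ∷ # 3 ∷ # 0 ∷ # 2 ∷ [])
    ∷ (# 3 ∷ # 6 ∷ # 0 ∷ # 0 ∷ # 5 ∷ # 4 ∷ # 1 ∷ [])
    ∷ (# 2 ∷ # 4 ∷ # 0 ∷ # 0 ∷ # 1 ∷ # 6 ∷ # 5 ∷ [])
    ∷ (# 6 ∷ # 3 ∷ # 5 ∷ # 1 ∷ # 0 ∷ # 2 ∷ # 0 ∷ [])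
    ∷ (# 1 ∷ # 0 ∷ # 4 ∷ # 6 ∷ # 2 ∷ # 0 ∷ # 3 ∷ [])
    ∷ (# 4 ∷ # 2 ∷ # 1 ∷ # 5 ∷ # 0 ∷ # 3 ∷ # 0 ∷ [])
    ∷ [])
  ∷ ( (# 0 ∷ # 4 ∷ # 1 ∷ # 5 ∷ # 2 ∷ # 6 ∷ # 3 ∷ [])
    ∷ (# 4 ∷ # 0 ∷ # 5 ∷ # 2 ∷ # 6 ∷ # 3 ∷ # 0 ∷ [])
    ∷ (# 1 ∷ # 5 ∷ # 0 ∷ # 6 ∷ # 3 ∷ # 0 ∷ # 4 ∷ [])
    ∷ (# 5 ∷ # 2 ∷ # 6 ∷ # 0 ∷ # 0 ∷ # 4 ∷ # 1 ∷ [])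
    ∷ (# 2 ∷ # 6 ∷ # 3 ∷ # 0 ∷ # 0 ∷ # 1 ∷ # 5 ∷ [])
    ∷ (# 6 ∷ # 3 ∷ # 0 ∷ # 4 ∷ # 1 ∷ # 0 ∷ # 2 ∷ [])
    ∷ (# 3 ∷ # 0 ∷ # 4 ∷ # 1 ∷ # 5 ∷ # 2 ∷ # 0 ∷ [])
    ∷ [])
  ∷ []

table₉ : Vec (Vec (Vec (Fin 9) 9) 9) 3
table₉ =
    ( (# 0 ∷ # 8 ∷ # 4 ∷ # 6 ∷ # 5 ∷ # 1 ∷ # 3 ∷ # 2 ∷ # 7 ∷ [])
    ∷ (# 8 ∷ # 0 ∷ # 0 ∷ # 5 ∷ # 7 ∷ # 6 ∷ # 2 ∷ # 4 ∷ # 3 ∷ [])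
    ∷ (# 4 ∷ # 0 ∷ # 0 ∷ # 1 ∷ # 6 ∷ # 8 ∷ # 7 ∷ # 3 ∷ # 5 ∷ [])
    ∷ (# 6 ∷ # 5 ∷ # 1 ∷ # 0 ∷ # 2 ∷ # 7 ∷ # 0 ∷ # 8 ∷ # 4 ∷ [])
    ∷ (# 5 ∷ # 7 ∷ # 6 ∷ # 2 ∷ # 0 ∷ # 3 ∷ # 8 ∷ # 1 ∷ # 0 ∷ [])
    ∷ (# 1 ∷ # 6 ∷ # 8 ∷ # 7 ∷ # 3 ∷ # 0 ∷ # 4 ∷ # 0 ∷ # 2 ∷ [])
    ∷ (# 3 ∷ # 2 ∷ # 7 ∷ # 0 ∷ # 8 ∷ # 4 ∷ # 0 ∷ # 5 ∷ # 1 ∷ [])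
    ∷ (# 2 ∷ # 4 ∷ # 3 ∷ # 8 ∷ # 1 ∷ # 0 ∷ # 5 ∷ # 0 ∷ # 6 ∷ [])
    ∷ (# 7 ∷ # 3 ∷ # 5 ∷ # 4 ∷ # 0 ∷ # 2 ∷ # 1 ∷ # 6 ∷ # 0 ∷ [])
    ∷ [])
  ∷ ( (# 0 ∷ # 2 ∷ # 6 ∷ # 8 ∷ # 7 ∷ # 3 ∷ # 5 ∷ # 4 ∷ # 1 ∷ [])
    ∷ (# 2 ∷ # 0 ∷ # 3 ∷ # 7 ∷ # 0 ∷ # 8 ∷ # 4 ∷ # 6 ∷ # 5 ∷ [])
    ∷ (# 6 ∷ # 3 ∷ # 0 ∷ # 4 ∷ # 8 ∷ # 1 ∷ # 0 ∷ # 5 ∷ # 7 ∷ [])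
    ∷ (# 8 ∷ # 7 ∷ # 4 ∷ # 0 ∷ # 5 ∷ # 0 ∷ # 2 ∷ # 1 ∷ # 6 ∷ [])
    ∷ (# 7 ∷ # 0 ∷ # 8 ∷ # 5 ∷ # 0 ∷ # 6 ∷ # 1 ∷ # 3 ∷ # 2 ∷ [])
    ∷ (# 3 ∷ # 8 ∷ # 1 ∷ # 0 ∷ # 6 ∷ # 0 ∷ # 7 ∷ # 2 ∷ # 4 ∷ [])
    ∷ (# 5 ∷ # 4 ∷ # 0 ∷ # 2 ∷ # 1 ∷ # 7 ∷ # 0 ∷ # 8 ∷ # 3 ∷ [])
    ∷ (# 4 ∷ # 6 ∷ # 5 ∷ # 1 ∷ # 3 ∷ # 2 ∷ # 8 ∷ # 0 ∷ # 0 ∷ [])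
    ∷ (# 1 ∷ # 5 ∷ # 7 ∷ # 6 ∷ # 2 ∷ # 4 ∷ # 3 ∷ # 0 ∷ # 0 ∷ [])
    ∷ [])
  ∷ ( (# 0 ∷ # 7 ∷ # 3 ∷ # 5 ∷ # 8 ∷ # 4 ∷ # 2 ∷ # 1 ∷ # 6 ∷ [])
    ∷ (# 7 ∷ # 0 ∷ # 8 ∷ # 4 ∷ # 6 ∷ # 0 ∷ # 5 ∷ # 3 ∷ # 2 ∷ [])
    ∷ (# 3 ∷ # 8 ∷ # 0 ∷ # 0 ∷ # 5 ∷ # 7 ∷ # 1 ∷ # 6 ∷ # 4 ∷ [])
    ∷ (# 5 ∷ # 4 ∷ # 0 ∷ # 0 ∷ # 1 ∷ # 6 ∷ # 8 ∷ # 2 ∷ # 7 ∷ [])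
    ∷ (# 8 ∷ # 6 ∷ # 5 ∷ # 1 ∷ # 0 ∷ # 2 ∷ # 7 ∷ # 0 ∷ # 3 ∷ [])
    ∷ (# 4 ∷ # 0 ∷ # 7 ∷ # 6 ∷ # 2 ∷ # 0 ∷ # 3 ∷ # 8 ∷ # 1 ∷ [])
    ∷ (# 2 ∷ # 5 ∷ # 1 ∷ # 8 ∷ # 7 ∷ # 3 ∷ # 0 ∷ # 4 ∷ # 0 ∷ [])
    ∷ (# 1 ∷ # 3 ∷ # 6 ∷ # 2 ∷ # 0 ∷ # 8 ∷ # 4 ∷ # 0 ∷ # 5 ∷ [])
    ∷ (# 6 ∷ # 2 ∷ # 4 ∷ # 7 ∷ # 3 ∷ # 1 ∷ # 0 ∷ # 5 ∷ # 0 ∷ [])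
    ∷ [])
  ∷ []

colouring₄ : PairColouring 3 (Fin 4) (Fin 3)
colouring₄ = Decide.fromDecisions (fromTable table₄) _ _ _ _

joinK₄ : ∀ {m} .{{_ : NonZero m}} → 4 ≤ m →
         ∃[ l ] PairColouring 3 (Fin m) (Fin l) → ∃[ l ] PairColouring 3 (Fin (4 + m)) (Fin l)
joinK₄ {m} 4≤m (l , P) =
  3 + (l + m) ,
  recolour (↔⇒↣ (↔-sym (↔-trans +↔⊎ (↔-refl ⊎-↔ +↔⊎))))
    (relabel +↔⊎ (joinCliques (cyclicLatinRectangle (n≤1+n 3)) (cyclicLatinRectangle 4≤m) colouring₄ P))

pairColouring : ∀ n → n ≢ 0 → n ≢ 2 → n ≢ 3 → n ≢ 5 → ∃[ l ] PairColouring 3 (Fin n) (Fin l)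
pairColouring 0 n≢0 _ _ _ = ⊥-elim (n≢0 refl)
pairColouring 1 _ _ _ _ = 1 , Decide.fromDecisions (fromTable table₁) _ _ _ _
pairColouring 2 _ n≢2 _ _ = ⊥-elim (n≢2 refl)
pairColouring 3 _ _ n≢3 _ = ⊥-elim (n≢3 refl)
pairColouring 4 _ _ _ _ = 3 , colouring₄
pairColouring 5 _ _ _ n≢5 = ⊥-elim (n≢5 refl)
pairColouring 6 _ _ _ _ = 5 , Decide.fromDecisions (fromTable table₆) _ _ _ _
pairColouring 7 _ _ _ _ = 7 , Decide.fromDecisions (fromTable table₇) _ _ _ _
pairColouring 8 _ _ _ _ = joinK₄ ≤-refl (3 , colouring₄)
pairColouring 9 _ _ _ _ = 9 , Decide.fromDecisions (fromTable table₉) _ _ _ _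
pairColouring (suc (suc (suc (suc m@(suc (suc (suc (suc (suc (suc _)))))))))) _ _ _ _ =
  joinK₄ (s≤s (s≤s (s≤s (s≤s z≤n)))) (pairColouring m (λ ()) (λ ()) (λ ()) (λ ()))

theorem2p11 : (n : ℕ) → ¬ (n ≡ 0) → ¬ (n ≡ 2) → ¬ (n ≡ 3) → ¬ (n ≡ 5) →
    AdmitsSimultaneous 2 n × AdmitsSimultaneous 3 n
theorem2p11 n n≢0 n≢2 n≢3 n≢5 with pairColouring n n≢0 n≢2 n≢3 n≢5
... | l , P = (l , restrict (mk↣ inject₁-injective) (toSimultaneous P)) , (l , toSimultaneous P)
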